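{- Let $n\geq 5$ be odd, and let $S = \{2, n-1\}\cup\{x\in\{1,\dots,n-1\} : x\equiv 0 \pmod 4\}\subseteq \mathbb{Z}_n$. Let $D$ be the Cayley digraph with vertex set $\mathbb{Z}_n$ and an arc from $u$ to $v$ whenever $u-v\in S$. Then $D$ is an oriented graph which is a simple oriented clique, i.e. $\chi_s(D)=n$.
   Context: An oriented graph is a $(1,0)$-mixed graph: a loopless digraph with at most one arc between any pair of vertices. A simple homomorphism $\phi: G\to_s H$ of oriented graphs is a map $V(G)\to V(H)$ such that either $|V(G)|=1$, or $\phi$ is non-constant and for every arc $uv$ of $G$ with $\phi(u)\neq\phi(v)$, $\phi(u)\phi(v)$ is an arc of $H$ (same direction). $\chi_s(G)$ is the least number of vertices of an oriented graph $H$ with $G\to_s H$; $G$ is a simple clique if $\chi_s(G)=|V(G)|$. -}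

module Defs where

open import Data.Nat using (ℕ; suc; _+_; _∸_; _≤_; _≤ᵇ_)
open import Data.Bool using (if_then_else_)
open import Data.Nat.Divisibility using (_∣_)
open import Data.Fin using (Fin; toℕ)
open import Data.Product using (Σ; ∃; _×_; _,_)
open import Data.Sum using (_⊎_)
open import Relation.Nullary using (¬_)
open import Relation.Binary.PropositionalEquality using (_≡_; _≢_)

Digraph : ℕ → Set₁
Digraph n = Fin n → Fin n → Set

IsOriented : {n : ℕ} → Digraph n → Set
IsOriented {n} A = (∀ u → ¬ A u u) × (∀ u v → A u v → ¬ A v u)

IsSimpleHom : {n k : ℕ} → Digraph n → Digraph k → (Fin n → Fin k) → Set
IsSimpleHom {n} G H φ =
  n ≡ 1 ⊎
  ((∃ λ u → ∃ λ v → φ u ≢ φ v) ×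
   (∀ u v → G u v → φ u ≢ φ v → H (φ u) (φ v)))

_→s_ : {n k : ℕ} → Digraph n → Digraph k → Set
G →s H = ∃ λ φ → IsSimpleHom G H φ

χs≡ : {n : ℕ} → Digraph n → ℕ → Set₁
χs≡ G m =
  (Σ (Digraph m) λ H → IsOriented H × (G →s H)) ×
  (∀ k (H : Digraph k) → IsOriented H → G →s H → m ≤ k)

-- Connection set S = {2, n-1} ∪ {x ∈ {1..n-1} : x ≡ 0 mod 4}, as a predicate on ℕ
-- (applied to representatives in {0..n-1}).
InS : ℕ → ℕ → Set
InS n x = x ≡ 2 ⊎ x ≡ n ∸ 1 ⊎ (1 ≤ x × x ≤ n ∸ 1 × 4 ∣ x)

diffMod : (n : ℕ) → Fin n → Fin n → ℕ
diffMod n u v = if toℕ v ≤ᵇ toℕ u then toℕ u ∸ toℕ v else (n + toℕ u) ∸ toℕ v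

CayleyD : (n : ℕ) → Digraph n
CayleyD n u v = InS n (diffMod n u v)

-- A simple homomorphism φ into an oriented graph cannot map both ends of a
-- two-arc path u → w → v to one vertex without mapping w there too, since
-- otherwise H would contain arcs in both directions between φ u and φ w.
-- Thus if a colour class contains x and x + t + s with t, s ∈ S, it contains
-- x + t. Two vertices at distance 4j or 4j + 2 in a class therefore give two
-- at distance 2, whence two consecutive ones, and the class is everything.
-- For odd n every distance e or its complement n - e is even, so φ is
-- injective and χ_s(D) = n. Oddness also makes D oriented: all
-- elements of S except n - 1 are even and 1 ∉ S, so S ∩ (n - S) = ∅.
module Submission where

open import Defs
open import Data.Nat
open import Data.Nat.Properties
open import Data.Nat.DivMod
open import Data.Nat.Divisibility using (_∣_; divides; ∣-trans; ∣1⇒≡1; ∣m∣n⇒∣m+n)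
open import Data.Nat.Tactic.RingSolver using (solve-∀)
open import Data.Bool using (true; false)
open import Data.Empty using (⊥; ⊥-elim)
open import Data.Fin using (Fin; toℕ; zero; suc)
open import Data.Fin.Properties
  using (toℕ<n; toℕ-injective; toℕ-fromℕ<; fromℕ<-toℕ; fromℕ<-cong; injective⇒≤)
  renaming (_≟_ to _≟ᶠ_)
open import Data.Product using (_×_; _,_; proj₁)
open import Data.Sum using (_⊎_; inj₁; inj₂)
open import Function using (_∘_; id)
open import Relation.Nullary using (¬_; yes; no)
open import Relation.Binary using (tri<; tri≈; tri>)
open import Relation.Binary.PropositionalEquality
open ≡-Reasoning

PreservesArcs : {n k : ℕ} → Digraph n → Digraph k → (Fin n → Fin k) → Set
PreservesArcs G H φ = ∀ u v → G u v → φ u ≢ φ v → H (φ u) (φ v)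

→s-refl : {m : ℕ} (G : Digraph (2 + m)) → G →s G
→s-refl G = id , inj₂ ((zero , suc zero , λ ()) , λ _ _ uv _ → uv)

squeeze : {n k : ℕ} {G : Digraph n} {H : Digraph k} {φ : Fin n → Fin k} →
          IsOriented H → PreservesArcs G H φ →
          ∀ {a w b} → G a w → G w b → φ a ≡ φ b → φ w ≡ φ a
squeeze {H = H} {φ} (_ , antisym) hom {a} {w} {b} aw wb a≡b with φ w ≟ᶠ φ a
... | yes w≡a = w≡a
... | no w≢a = ⊥-elim (antisym (φ a) (φ w) into out)
  where
    into : H (φ a) (φ w)
    into = hom a w aw (w≢a ∘ sym)
    out : H (φ w) (φ a)
    out = subst (H (φ w)) (sym a≡b) (hom w b wb (λ w≡b → w≢a (trans w≡b (sym a≡b))))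

[o+m∸n]+[n∸m]≡o : ∀ {m n o} → m < n → n ≤ o → (o + m ∸ n) + (n ∸ m) ≡ o
[o+m∸n]+[n∸m]≡o {m} {n} {o} m<n n≤o = begin
  (o + m ∸ n) + (n ∸ m) ≡⟨ +-∸-assoc (o + m ∸ n) (<⇒≤ m<n) ⟨
  (o + m ∸ n + n) ∸ m   ≡⟨ cong (_∸ m) (m∸n+n≡m (≤-trans n≤o (m≤m+n o m))) ⟩
  o + m ∸ m             ≡⟨ m+n∸n≡m o m ⟩
  o                     ∎

m+n≡o⇒m≤o∸1 : ∀ {m n o} → m + n ≡ o → 1 ≤ n → m ≤ o ∸ 1
m+n≡o⇒m≤o∸1 {m} {suc n} refl _ = subst (m ≤_) (cong (_∸ 1) (sym (+-suc m n))) (m≤m+n m n)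

module _ {n : ℕ} where

  diffMod-≤ : (u v : Fin n) → toℕ v ≤ toℕ u → diffMod n u v ≡ toℕ u ∸ toℕ v
  diffMod-≤ u v v≤u with toℕ v ≤ᵇ toℕ u | ≤⇒≤ᵇ v≤u
  ... | true  | _ = refl
  ... | false | ()

  diffMod-> : (u v : Fin n) → toℕ u < toℕ v → diffMod n u v ≡ n + toℕ u ∸ toℕ v
  diffMod-> u v u<v with toℕ v ≤ᵇ toℕ u | ≤ᵇ⇒≤ (toℕ v) (toℕ u)
  ... | true  | v≤u = ⊥-elim (<⇒≱ u<v (v≤u _))
  ... | false | _   = refl

  diffMod-self : (u : Fin n) → diffMod n u u ≡ 0
  diffMod-self u = trans (diffMod-≤ u u ≤-refl) (n∸n≡0 (toℕ u))

  diffMod-complement : {u v : Fin n} → u ≢ v → diffMod n u v + diffMod n v u ≡ n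
  diffMod-complement {u} {v} u≢v with <-cmp (toℕ u) (toℕ v)
  ... | tri< u<v _ _ rewrite diffMod-> u v u<v | diffMod-≤ v u (<⇒≤ u<v) =
    [o+m∸n]+[n∸m]≡o u<v (<⇒≤ (toℕ<n v))
  ... | tri≈ _ u≡v _ = ⊥-elim (u≢v (toℕ-injective u≡v))
  ... | tri> _ _ v<u rewrite diffMod-≤ u v (<⇒≤ v<u) | diffMod-> v u v<u =
    trans (+-comm (toℕ u ∸ toℕ v) _) ([o+m∸n]+[n∸m]≡o v<u (<⇒≤ (toℕ<n u)))

  diffMod-unique : .{{_ : NonZero n}} (u v : Fin n) {d : ℕ} → d < n →
                   toℕ u ≡ (toℕ v + d) % n → diffMod n u v ≡ d
  diffMod-unique u v {d} d<n u≡ with toℕ v + d <? n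
  ... | yes no-wrap = begin
    diffMod n u v ≡⟨ diffMod-≤ u v (subst (b ≤_) (sym u≡b+d) (m≤m+n b d)) ⟩
    a ∸ b         ≡⟨ cong (_∸ b) u≡b+d ⟩
    b + d ∸ b     ≡⟨ m+n∸m≡n b d ⟩
    d             ∎
    where
      a b : ℕ
      a = toℕ u
      b = toℕ v
      u≡b+d : a ≡ b + d
      u≡b+d = trans u≡ (m<n⇒m%n≡m no-wrap)
  ... | no wrap = begin
    diffMod n u v       ≡⟨ diffMod-> u v (subst (_< b) (sym u≡b+d∸n) b+d∸n<b) ⟩
    n + a ∸ b           ≡⟨ cong (λ x → n + x ∸ b) u≡b+d∸n ⟩
    n + (b + d ∸ n) ∸ b ≡⟨ cong (_∸ b) (m+[n∸m]≡n n≤b+d) ⟩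
    b + d ∸ b           ≡⟨ m+n∸m≡n b d ⟩
    d                   ∎
    where
      a b : ℕ
      a = toℕ u
      b = toℕ v
      n≤b+d : n ≤ b + d
      n≤b+d = ≮⇒≥ wrap
      b+d∸n<b : b + d ∸ n < b
      b+d∸n<b = subst (b + d ∸ n <_) (m+n∸n≡m b n) (∸-monoˡ-< (+-monoʳ-< b d<n) n≤b+d)
      u≡b+d∸n : a ≡ b + d ∸ n
      u≡b+d∸n = begin
        a                ≡⟨ u≡ ⟩
        (b + d) % n      ≡⟨ m≤n⇒[n∸m]%m≡n%m n≤b+d ⟨
        (b + d ∸ n) % n  ≡⟨ m<n⇒m%n≡m (<-trans b+d∸n<b (toℕ<n v)) ⟩
        b + d ∸ n        ∎

  diffMod-shift : .{{_ : NonZero n}} (x : ℕ) {d : ℕ} → d < n →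
                  diffMod n ((x + d) mod n) (x mod n) ≡ d
  diffMod-shift x {d} d<n = diffMod-unique ((x + d) mod n) (x mod n) d<n (begin
    toℕ ((x + d) mod n)          ≡⟨ toℕ-fromℕ< (m%n<n (x + d) n) ⟩
    (x + d) % n                  ≡⟨ %-distribˡ-+ x d n ⟩
    (x % n + d % n) % n          ≡⟨ cong (λ r → (x % n + r) % n) (m<n⇒m%n≡m d<n) ⟩
    (x % n + d) % n              ≡⟨ cong (λ r → (r + d) % n) (toℕ-fromℕ< (m%n<n x n)) ⟨
    (toℕ (x mod n) + d) % n      ∎)

data ParityView : ℕ → Set where
  even : ∀ k → ParityView (k * 2)
  odd  : ∀ k → ParityView (suc (k * 2))

parityView : ∀ e → ParityView e
parityView zero = even 0
parityView (suc e) with parityView e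
... | even k = odd k
... | odd k  = even (suc k)

-- Writing n = 3 + m makes n ∸ 1 reduce to 2 + m.
module Cayley (m : ℕ) where

  n : ℕ
  n = 3 + m

  InS⇒< : ∀ {d} → InS n d → d < n
  InS⇒< (inj₁ refl)                 = s≤s (s≤s (s≤s z≤n))
  InS⇒< (inj₂ (inj₁ refl))          = ≤-refl
  InS⇒< (inj₂ (inj₂ (_ , d≤ , _))) = s≤s d≤

  0∉S : ¬ InS n 0
  0∉S (inj₁ ())
  0∉S (inj₂ (inj₁ ()))
  0∉S (inj₂ (inj₂ (() , _)))

  InS⇒even⊎last : ∀ {d} → InS n d → 2 ∣ d ⊎ d ≡ n ∸ 1
  InS⇒even⊎last (inj₁ refl)                 = inj₁ (divides 1 refl)
  InS⇒even⊎last (inj₂ (inj₁ d≡))            = inj₂ d≡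
  InS⇒even⊎last (inj₂ (inj₂ (_ , _ , 4∣d))) = inj₁ (∣-trans (divides 2 refl) 4∣d)

  1∉S : ¬ InS n 1
  1∉S 1∈S with InS⇒even⊎last 1∈S
  ... | inj₁ 2∣1 with () ← ∣1⇒≡1 2∣1
  ... | inj₂ ()

  last+d≡n⇒d≡1 : ∀ {d} → (n ∸ 1) + d ≡ n → d ≡ 1
  last+d≡n⇒d≡1 {d} eq = +-cancelˡ-≡ (n ∸ 1) d 1 (trans eq (+-comm 1 (n ∸ 1)))

  no-complementary-pair : ¬ 2 ∣ n → ∀ {d d'} → d + d' ≡ n → InS n d → InS n d' → ⊥
  no-complementary-pair n-odd {d} {d'} sum d∈S d'∈S with InS⇒even⊎last d∈S | InS⇒even⊎last d'∈S
  ... | inj₁ 2∣d    | inj₁ 2∣d'   = n-odd (subst (2 ∣_) sum (∣m∣n⇒∣m+n 2∣d 2∣d'))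
  ... | inj₂ refl   | _           = 1∉S (subst (InS n) (last+d≡n⇒d≡1 sum) d'∈S)
  ... | _           | inj₂ refl   =
    1∉S (subst (InS n) (last+d≡n⇒d≡1 (trans (+-comm (n ∸ 1) d) sum)) d∈S)

  CayleyD-oriented : ¬ 2 ∣ n → IsOriented (CayleyD n)
  CayleyD-oriented n-odd = loopless , antisymmetric
    where
      loopless : ∀ u → ¬ CayleyD n u u
      loopless u uu = 0∉S (subst (InS n) (diffMod-self u) uu)
      antisymmetric : ∀ u v → CayleyD n u v → ¬ CayleyD n v u
      antisymmetric u v uv vu with u ≟ᶠ v
      ... | yes refl = loopless u uv
      ... | no u≢v   = no-complementary-pair n-odd (diffMod-complement u≢v) uv vu

  arc-shift : ∀ x {s} → InS n s → CayleyD n ((x + s) mod n) (x mod n)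
  arc-shift x s∈S = subst (InS n) (sym (diffMod-shift x (InS⇒< s∈S))) s∈S

  last∈S : InS n (n ∸ 1)
  last∈S = inj₂ (inj₁ refl)

  multiple-of-4∈S : ∀ j → suc j * 4 ≤ n ∸ 1 → InS n (suc j * 4)
  multiple-of-4∈S j bound = inj₂ (inj₂ (s≤s z≤n , bound , divides (suc j) refl))

  mod-toℕ : (u : Fin n) → toℕ u mod n ≡ u
  mod-toℕ u = trans (fromℕ<-cong _ _ (m<n⇒m%n≡m (toℕ<n u)) _ (toℕ<n u)) (fromℕ<-toℕ u (toℕ<n u))

  module Fibre (n-odd : ¬ 2 ∣ n) {k : ℕ} {H : Digraph k} (H-oriented : IsOriented H)
               {φ : Fin n → Fin k} (hom : PreservesArcs (CayleyD n) H φ) (c : Fin k) where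

    InFibre : ℕ → Set
    InFibre x = φ (x mod n) ≡ c

    FibreIsWhole : Set
    FibreIsWhole = ∀ u → φ u ≡ c

    Collapses : ℕ → Set
    Collapses e = ∀ x → InFibre x → InFibre (x + e) → FibreIsWhole

    InFibre-% : ∀ x y → x % n ≡ y % n → InFibre x → InFibre y
    InFibre-% x y eq = subst (λ u → φ u ≡ c) (fromℕ<-cong _ _ eq (m%n<n x n) (m%n<n y n))

    InFibre-+n : ∀ x → InFibre x → InFibre (x + n)
    InFibre-+n x = InFibre-% x (x + n) (sym ([m+n]%n≡m%n x n))

    between : ∀ x {t s} → InS n t → InS n s → InFibre x → InFibre (x + t + s) → InFibre (x + t)
    between x {t} t∈S s∈S x∈F y∈F =
      trans (squeeze H-oriented hom (arc-shift (x + t) s∈S) (arc-shift x t∈S) (trans y∈F (sym x∈F)))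
            y∈F

    consecutive⇒all-shifts : ∀ x → InFibre x → InFibre (x + 1) → ∀ j → InFibre (x + j)
    consecutive⇒all-shifts x x∈F x+1∈F j = proj₁ (pairs j)
      where
        pairs : ∀ j → InFibre (x + j) × InFibre (x + suc j)
        pairs zero    = subst InFibre (sym (+-identityʳ x)) x∈F , x+1∈F
        pairs (suc j) with pairs j
        ... | x+j∈F , x+j+1∈F = x+j+1∈F , subst InFibre (shift-2 x j)
          (between (x + j) (inj₁ refl) last∈S x+j∈F
            (subst InFibre (wrap-around x j m) (InFibre-+n (x + suc j) x+j+1∈F)))
          where
            shift-2 : ∀ x j → x + j + 2 ≡ x + suc (suc j)
            shift-2 = solve-∀
            wrap-around : ∀ x j m → x + suc j + (3 + m) ≡ x + j + 2 + (2 + m)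
            wrap-around = solve-∀

    collapses-1 : Collapses 1
    collapses-1 x x∈F x+1∈F u = subst (λ v → φ v ≡ c) (mod-toℕ u)
      (InFibre-% (x + j) (toℕ u) x+j≡u (consecutive⇒all-shifts x x∈F x+1∈F j))
      where
        j : ℕ
        j = (2 + m) * x + toℕ u
        rearrange : ∀ x y m → x + ((2 + m) * x + y) ≡ y + x * (3 + m)
        rearrange = solve-∀
        x+j≡u : (x + j) % n ≡ toℕ u % n
        x+j≡u = trans (cong (_% n) (rearrange x (toℕ u) m)) ([m+kn]%n≡m%n (toℕ u) x n)

    collapses-complement : ∀ {e e'} → e + e' ≡ n → Collapses e → Collapses e'
    collapses-complement {e} {e'} sum collapses x x∈F y∈F =
      collapses (x + e') y∈F (subst InFibre x+n≡y+e (InFibre-+n x x∈F))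
      where
        x+n≡y+e : x + n ≡ x + e' + e
        x+n≡y+e = begin
          x + n        ≡⟨ cong (x +_) (trans (sym sum) (+-comm e e')) ⟩
          x + (e' + e) ≡⟨ +-assoc x e' e ⟨
          x + e' + e   ∎

    collapses-+ : ∀ {t s} → InS n t → InS n s → Collapses t → Collapses (t + s)
    collapses-+ {t} {s} t∈S s∈S collapses x x∈F y∈F =
      collapses x x∈F (between x t∈S s∈S x∈F (subst InFibre (sym (+-assoc x t s)) y∈F))

    collapses-+n⁻ : ∀ {e} → Collapses (e + n) → Collapses e
    collapses-+n⁻ {e} collapses x x∈F y∈F =
      collapses x x∈F (subst InFibre (+-assoc x e n) (InFibre-+n (x + e) y∈F))

    collapses-last : Collapses (n ∸ 1)
    collapses-last = collapses-complement {1} refl collapses-1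

    -- n - 2 ≡ 2 (n - 1) modulo n.
    collapses-2 : Collapses 2
    collapses-2 = collapses-complement {1 + m} (+-comm (1 + m) 2) (collapses-+n⁻
                    (subst Collapses (double-last m) (collapses-+ last∈S last∈S collapses-last)))
      where
        double-last : ∀ m → (2 + m) + (2 + m) ≡ (1 + m) + (3 + m)
        double-last = solve-∀

    collapses-4* : ∀ j → suc j * 4 ≤ n ∸ 1 → Collapses (suc j * 4)
    collapses-4* zero    _     = collapses-+ (inj₁ refl) (inj₁ refl) collapses-2
    collapses-4* (suc j) bound =
      collapses-+ (multiple-of-4∈S 0 4≤) (multiple-of-4∈S j bound') (collapses-4* 0 4≤)
      where
        4≤ : 4 ≤ n ∸ 1
        4≤ = ≤-trans (m≤m+n 4 (suc j * 4)) bound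
        bound' : suc j * 4 ≤ n ∸ 1
        bound' = ≤-trans (m≤n+m (suc j * 4) 4) bound

    collapses-4*+2 : ∀ j → j * 4 + 2 ≤ n ∸ 1 → Collapses (j * 4 + 2)
    collapses-4*+2 zero    _     = collapses-2
    collapses-4*+2 (suc j) bound =
      collapses-+ (multiple-of-4∈S j bound') (inj₁ refl) (collapses-4* j bound')
      where
        bound' : suc j * 4 ≤ n ∸ 1
        bound' = ≤-trans (m≤m+n (suc j * 4) 2) bound

    collapses-even : ∀ k → 1 ≤ k * 2 → k * 2 ≤ n ∸ 1 → Collapses (k * 2)
    collapses-even k 1≤e bound with parityView k
    ... | even zero    = ⊥-elim (<⇒≱ 1≤e z≤n)
    ... | even (suc j) = subst Collapses (sym (*-assoc (suc j) 2 2))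
                           (collapses-4* j (subst (_≤ n ∸ 1) (*-assoc (suc j) 2 2) bound))
    ... | odd j        = subst Collapses (four-j+2 j)
                           (collapses-4*+2 j (subst (_≤ n ∸ 1) (sym (four-j+2 j)) bound))
      where
        four-j+2 : ∀ j → j * 4 + 2 ≡ suc (j * 2) * 2
        four-j+2 = solve-∀

    collapses : ∀ {e e'} → e + e' ≡ n → 1 ≤ e → 1 ≤ e' → Collapses e
    collapses {e} {e'} sum 1≤e 1≤e' with parityView e | parityView e'
    ... | even k | _      = collapses-even k 1≤e (m+n≡o⇒m≤o∸1 sum 1≤e')
    ... | odd k  | even l = collapses-complement (trans (+-comm e' e) sum)
                              (collapses-even l 1≤e' (m+n≡o⇒m≤o∸1 (trans (+-comm e' e) sum) 1≤e))
    ... | odd k  | odd l  = ⊥-elim (n-odd (divides (suc (k + l)) (trans (sym sum) (odd+odd k l))))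
      where
        odd+odd : ∀ k l → suc (k * 2) + suc (l * 2) ≡ suc (k + l) * 2
        odd+odd = solve-∀

    two-in-fibre<⇒whole : ∀ {u v} → toℕ u < toℕ v → φ u ≡ c → φ v ≡ c → FibreIsWhole
    two-in-fibre<⇒whole {u} {v} u<v u∈F v∈F =
      collapses (m+[n∸m]≡n e≤n) (m<n⇒0<n∸m u<v) (m<n⇒0<n∸m e<n) (toℕ u) (toInFibre u∈F)
        (subst InFibre (sym (m+[n∸m]≡n (<⇒≤ u<v))) (toInFibre v∈F))
      where
        e : ℕ
        e = toℕ v ∸ toℕ u
        e<n : e < n
        e<n = ≤-<-trans (m∸n≤m (toℕ v) (toℕ u)) (toℕ<n v)
        e≤n : e ≤ n
        e≤n = <⇒≤ e<n
        toInFibre : ∀ {w} → φ w ≡ c → InFibre (toℕ w)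
        toInFibre {w} = subst (λ x → φ x ≡ c) (sym (mod-toℕ w))

    two-in-fibre⇒whole : ∀ {u v} → u ≢ v → φ u ≡ c → φ v ≡ c → FibreIsWhole
    two-in-fibre⇒whole {u} {v} u≢v u∈F v∈F with <-cmp (toℕ u) (toℕ v)
    ... | tri< u<v _ _ = two-in-fibre<⇒whole u<v u∈F v∈F
    ... | tri≈ _ u≡v _ = ⊥-elim (u≢v (toℕ-injective u≡v))
    ... | tri> _ _ v<u = two-in-fibre<⇒whole v<u v∈F u∈F

  χs-lower-bound : ¬ 2 ∣ n → ∀ k (H : Digraph k) → IsOriented H → CayleyD n →s H → n ≤ k
  χs-lower-bound n-odd k H H-oriented (φ , inj₂ ((u , v , φu≢φv) , hom)) = injective⇒≤ injective
    where
      injective : ∀ {x y} → φ x ≡ φ y → x ≡ y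
      injective {x} {y} φx≡φy with x ≟ᶠ y
      ... | yes x≡y = x≡y
      ... | no x≢y  = ⊥-elim (φu≢φv (trans (whole u) (sym (whole v))))
        where
          whole : ∀ w → φ w ≡ φ x
          whole = Fibre.two-in-fibre⇒whole n-odd H-oriented hom (φ x) x≢y refl (sym φx≡φy)

open Cayley using (CayleyD-oriented; χs-lower-bound)

mainTheorem16 : (n : ℕ) → 5 ≤ n → ¬ (2 ∣ n) →
    IsOriented (CayleyD n) × χs≡ (CayleyD n) n
mainTheorem16 .(5 + m) (s≤s (s≤s (s≤s (s≤s (s≤s {n = m} z≤n))))) n-odd =
  CayleyD-oriented (2 + m) n-odd ,
  ((CayleyD _ , CayleyD-oriented (2 + m) n-odd , →s-refl _) , χs-lower-bound (2 + m) n-odd)
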